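{- Let $\Sigma,X_1,X_2$ be finite sets of propositions with $\Sigma\cap X_1=\Sigma\cap X_2=\emptyset$ and $X_1\cap X_2=\emptyset$; let $X=X_1\cup X_2$ and $\Sigma_i=\Sigma\cup X_i$ for $i=1,2$. Let $\varphi_1,\varphi_2$ be $\mathsf{MTL}$ formulae built from $\Sigma$, and $\psi_1,\psi_2$ formulae built from $\Sigma_1$ and $\Sigma_2$ respectively. Let $\zeta_1=ONF_{\Sigma_1}(\psi_1)$ and $\zeta_2=ONF_{\Sigma_2}(\psi_2)$. If $\varphi_1=\exists\downarrow X_1.\zeta_1$ and $\varphi_2=\exists\downarrow X_2.\zeta_2$, then $\varphi_1\wedge\varphi_2=\exists\downarrow X.(\zeta_1\wedge\zeta_2)$.
   Context: A finite timed word over a finite set $\Delta$ is $\rho=(\sigma,\tau)$ with $\sigma_i\in2^{\Delta}\setminus\{\emptyset\}$ and $\tau_1\le\dots\le\tau_n$ in $\mathbb{R}_{\ge0}$. $\mathsf{MTL}$ formulae use propositions, boolean connectives and $\mathsf{U}_I,\mathsf{S}_I$ ($I$ an interval with endpoints in $\mathbb{N}\cup\{\infty\}$) with the standard strict pointwise semantics; $\rho\models\varphi$ iff $\rho,1\models\varphi$. Abbreviations: $\Diamond_I\phi=true\,\mathsf{U}_I\phi$, $\Box_I\phi=\neg\Diamond_I\neg\phi$, $\Box=\Box_{[0,\infty)}$, $\bot=\neg true$. For disjoint finite $\Sigma,X$, a $(\Sigma,X)$-oversampled behaviour is a timed word $\rho'$ over $\Sigma\cup X$ whose first and last letters intersect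 $\Sigma$; its oversampled projection $\rho'\downarrow X$ is the timed word over $\Sigma$ obtained by deleting positions whose letter does not intersect $\Sigma$ and intersecting each remaining letter with $\Sigma$ (keeping time stamps). For $\phi$ built from $\Sigma$ and $\psi$ built from $\Sigma\cup X$, $\phi=\exists\downarrow X.\psi$ (equisatisfiability modulo oversampled projections) means: (i) every $(\Sigma,X)$-oversampled behaviour $\rho'$ with $\rho'\models\psi$ satisfies $\rho'\downarrow X\models\phi$; (ii) for every timed word $\rho$ over $\Sigma$ with $\rho\models\phi$ there is a $(\Sigma,X)$-oversampled behaviour $\rho'$ with $\rho'\models\psi$ and $\rho'\downarrow X=\rho$. For a finite set $\Gamma$ and $act=\bigvee\Gamma$, $ONF_\Gamma(\psi)$ is obtained by recursively replacing each $a\in\Gamma$ by $a\wedge act$, each $\phi_i\mathsf{U}_I\phi_j$ by $(act\rightarrow ONF_\Gamma(\phi_i))\mathsf{U}_I(ONF_\Gamma(\phi_j)\wedge act)$, each $\phi_i\mathsf{S}_I\phi_j$ by $(act\rightarrow ONF_\Gamma(\phi_i))\mathsf{S}_I(ONF_\Gamma(\phi_j)\wedge act)$, each $\Box_I\phi$ by $\Box_I(act\rightarrow ONF_\Gamma(\phi))$, each $\Diamond_I\phi$ by $\Diamond_I(\phi\wedge act)$, and conjoining the result with $act\wedge(\Box\bot\rightarrow act)$. -}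

module Defs where

open import Level using (0ℓ)
open import Data.Bool using (Bool; true; false)
open import Data.Maybe using (Maybe; just; nothing)
open import Data.Nat as ℕ using (ℕ; zero; suc)
open import Data.Fin as Fin using (Fin)
open import Data.List using (List; []; _∷_; _++_; [_]; length; lookup; map; filter; foldr)
open import Data.List.Relation.Unary.All using (All)
open import Data.List.Relation.Unary.Any using (Any; any?)
open import Data.List.Relation.Unary.Linked using (Linked)
open import Data.List.Relation.Binary.Pointwise using (Pointwise)
open import Data.List.Membership.Propositional using (_∈_)
open import Data.List.Membership.DecPropositional ℕ._≟_ using (_∈?_)
open import Data.Product using (Σ; ∃; _×_; _,_; proj₁; proj₂)
open import Data.Unit using (⊤)
open import Data.Empty using (⊥)
open import Relation.Nullary using (¬_; yes; no)
open import Relation.Binary.PropositionalEquality using (_≡_)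
open import Relation.Binary.Structures using (IsTotalOrder)
open import Algebra.Structures using (IsCommutativeRing)
open import Function.Bundles using (_⇔_)

-- An abstract model of the real numbers: a Dedekind-complete ordered
-- field (characterises ℝ up to isomorphism). The theorem quantifies over
-- every such model.

record Reals : Set₁ where
  infixl 6 _+_
  infixl 7 _*_
  field
    Carrier : Set
    _+_ _*_ : Carrier → Carrier → Carrier
    -_      : Carrier → Carrier
    0# 1#   : Carrier
    _≤_     : Carrier → Carrier → Set
    isCommutativeRing : IsCommutativeRing _≡_ _+_ _*_ -_ 0# 1#
    0≢1     : ¬ (0# ≡ 1#)
    inverse : ∀ x → ¬ (x ≡ 0#) → ∃ λ y → x * y ≡ 1#
    isTotalOrder : IsTotalOrder _≡_ _≤_
    +-mono-≤ : ∀ {x y} z → x ≤ y → (x + z) ≤ (y + z)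
    *-nonneg : ∀ {x y} → 0# ≤ x → 0# ≤ y → 0# ≤ (x * y)
    lub : (P : Carrier → Set) → ∃ P → (∃ λ b → ∀ x → P x → x ≤ b) →
          ∃ λ s → (∀ x → P x → x ≤ s) × (∀ b → (∀ x → P x → x ≤ b) → s ≤ b)

Atom : Set
Atom = ℕ

-- Interval with endpoints in ℕ ∪ {∞}; each finite endpoint is closed
-- (true) or open (false); hi = nothing means ∞ (hiClosed then ignored).
record Interval : Set where
  constructor interval
  field
    lo       : ℕ
    loClosed : Bool
    hi       : Maybe ℕ
    hiClosed : Bool

zeroInf : Interval
zeroInf = interval 0 true nothing false

data Formula : Set where
  atom  : Atom → Formula
  ttrue : Formula
  ¬'_   : Formula → Formula
  _∧'_  : Formula → Formula → Formula
  U     : Interval → Formula → Formula → Formula   -- U I φ ψ  =  φ U_I ψ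
  S     : Interval → Formula → Formula → Formula   -- S I φ ψ  =  φ S_I ψ

⊥' : Formula
⊥' = ¬' ttrue

_∨'_ : Formula → Formula → Formula
φ ∨' ψ = ¬' ((¬' φ) ∧' (¬' ψ))

_⇒'_ : Formula → Formula → Formula
φ ⇒' ψ = ¬' (φ ∧' (¬' ψ))

◇ : Interval → Formula → Formula
◇ I φ = U I ttrue φ

□ : Interval → Formula → Formula
□ I φ = ¬' (◇ I (¬' φ))

BuiltFrom : List Atom → Formula → Set
BuiltFrom Δ (atom a) = a ∈ Δ
BuiltFrom Δ ttrue = ⊤
BuiltFrom Δ (¬' φ) = BuiltFrom Δ φ
BuiltFrom Δ (φ ∧' ψ) = BuiltFrom Δ φ × BuiltFrom Δ ψ
BuiltFrom Δ (U I φ ψ) = BuiltFrom Δ φ × BuiltFrom Δ ψ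
BuiltFrom Δ (S I φ ψ) = BuiltFrom Δ φ × BuiltFrom Δ ψ

act : List Atom → Formula
act Γ = foldr (λ a f → atom a ∨' f) ⊥' Γ

onf : List Atom → Formula → Formula
onf Γ (atom a) with a ∈? Γ
... | yes _ = atom a ∧' act Γ
... | no _  = atom a
onf Γ ttrue = ttrue
onf Γ (¬' φ) = ¬' (onf Γ φ)
onf Γ (φ ∧' ψ) = onf Γ φ ∧' onf Γ ψ
onf Γ (U I φ ψ) = U I (act Γ ⇒' onf Γ φ) (onf Γ ψ ∧' act Γ)
onf Γ (S I φ ψ) = S I (act Γ ⇒' onf Γ φ) (onf Γ ψ ∧' act Γ)

ONF : List Atom → Formula → Formula
ONF Γ ψ = onf Γ ψ ∧' (act Γ ∧' (□ zeroInf ⊥' ⇒' act Γ))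

module Semantics (R : Reals) where
  open Reals R

  Time : Set
  Time = Carrier

  _-_ : Carrier → Carrier → Carrier
  x - y = x + (- y)

  _<_ : Carrier → Carrier → Set
  x < y = (x ≤ y) × ¬ (x ≡ y)

  ι : ℕ → Carrier
  ι zero = 0#
  ι (suc n) = 1# + ι n

  _∈I_ : Carrier → Interval → Set
  d ∈I interval lo lc hi hc = lower lc × upper hi hc
    where
    lower : Bool → Set
    lower true  = ι lo ≤ d
    lower false = ι lo < d
    upper : Maybe ℕ → Bool → Set
    upper nothing  _     = ⊤
    upper (just u) true  = d ≤ ι u
    upper (just u) false = d < ι u

  -- a letter is a finite set of propositions (given as a list)
  Letter : Set
  Letter = List Atom

  TimedWord : Set
  TimedWord = List (Letter × Time)

  IsTimedWordOver : List Atom → TimedWord → Set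
  IsTimedWordOver Δ ρ =
    ¬ (ρ ≡ []) ×
    All (λ p → ¬ (proj₁ p ≡ []) × All (_∈ Δ) (proj₁ p) × (0# ≤ proj₂ p)) ρ ×
    Linked (λ p q → proj₂ p ≤ proj₂ q) ρ

  letterAt : (ρ : TimedWord) → Fin (length ρ) → Letter
  letterAt ρ i = proj₁ (lookup ρ i)

  timeAt : (ρ : TimedWord) → Fin (length ρ) → Time
  timeAt ρ i = proj₂ (lookup ρ i)

  -- strict pointwise semantics
  sat : (ρ : TimedWord) → Fin (length ρ) → Formula → Set
  sat ρ i (atom a) = a ∈ letterAt ρ i
  sat ρ i ttrue = ⊤
  sat ρ i (¬' φ) = ¬ sat ρ i φ
  sat ρ i (φ ∧' ψ) = sat ρ i φ × sat ρ i ψ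
  sat ρ i (U I φ ψ) = Σ (Fin (length ρ)) λ j →
    (i Fin.< j) × ((timeAt ρ j - timeAt ρ i) ∈I I) × sat ρ j ψ ×
    (∀ k → i Fin.< k → k Fin.< j → sat ρ k φ)
  sat ρ i (S I φ ψ) = Σ (Fin (length ρ)) λ j →
    (j Fin.< i) × ((timeAt ρ i - timeAt ρ j) ∈I I) × sat ρ j ψ ×
    (∀ k → j Fin.< k → k Fin.< i → sat ρ k φ)

  -- ρ ⊨ φ iff ρ,1 ⊨ φ (timed words are nonempty)
  _⊨_ : TimedWord → Formula → Set
  [] ⊨ φ = ⊥
  (x ∷ ρ) ⊨ φ = sat (x ∷ ρ) Fin.zero φ

  Intersects : List Atom → Letter → Set
  Intersects Sig σ = Any (_∈ Sig) σ

  Oversampled : List Atom → List Atom → TimedWord → Set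
  Oversampled Sig X ρ =
    IsTimedWordOver (Sig ++ X) ρ ×
    (∀ {σ t ρ₀} → ρ ≡ (σ , t) ∷ ρ₀ → Intersects Sig σ) ×
    (∀ {ρ₀ σ t} → ρ ≡ ρ₀ ++ [ (σ , t) ] → Intersects Sig σ)

  -- oversampled projection ρ ↓ X (depends only on Σ)
  project : List Atom → TimedWord → TimedWord
  project Sig ρ =
    map (λ p → filter (_∈? Sig) (proj₁ p) , proj₂ p)
        (filter (λ p → any? (_∈? Sig) (proj₁ p)) ρ)

  -- equality of timed words (letters compared as sets)
  _≈W_ : TimedWord → TimedWord → Set
  _≈W_ = Pointwise (λ p q → (∀ a → (a ∈ proj₁ p) ⇔ (a ∈ proj₁ q)) × (proj₂ p ≡ proj₂ q))

  -- φ = ∃↓X. ψ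
  EquiSat : List Atom → List Atom → Formula → Formula → Set
  EquiSat Sig X φ ψ =
    (∀ ρ' → Oversampled Sig X ρ' → ρ' ⊨ ψ → project Sig ρ' ⊨ φ) ×
    (∀ ρ → IsTimedWordOver Sig ρ → ρ ⊨ φ →
       ∃ λ ρ' → Oversampled Sig X ρ' × ρ' ⊨ ψ × (project Sig ρ' ≈W ρ))

module Submission where

-- Every temporal operator of ONF_Γ ψ is guarded by act_Γ, so the formula only inspects the
-- Γ-active positions (those whose letter meets Γ). Two words whose Γ-active positions match
-- up in order, with equal time stamps and letters equal modulo Γ, therefore satisfy the same
-- ONF_Γ formulae (for ψ built from Γ).
-- (i) Restricting a model of ζ₁ ∧ ζ₂ to Σ ∪ X₁ gives a (Σ,X₁)-oversampled model of ζ₁ with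
-- the same Σ-projection, which therefore satisfies φ₁; likewise for φ₂.
-- (ii) Given (Σ,Xᵢ)-oversampled models ρᵢ of ζᵢ that both project to ρ, interleave them by
-- time, fusing the positions that carry the same Σ-letter. As X₁ ∩ X₂ = ∅, the Σ ∪ Xᵢ-active
-- positions of the interleaving are exactly those of ρᵢ, so it satisfies ζ₁ ∧ ζ₂, and it
-- still projects to ρ.

open import Defs
open import Data.Empty using (⊥; ⊥-elim)
open import Data.Fin as Fin using (Fin; zero; suc)
open import Data.Nat as ℕ using (z≤n; s≤s)
open import Data.List using (List; []; _∷_; _++_; [_]; length; filter; map)
open import Data.List.Properties using (filter-accept; filter-reject; filter-none; ++-conicalˡ)
open import Data.List.Membership.DecPropositional ℕ._≟_ using (_∈?_)
open import Data.List.Membership.Propositional using (_∈_; find; lose)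
open import Data.List.Membership.Propositional.Properties
  using (∈-filter⁺; ∈-filter⁻; ∈-++⁺ˡ; ∈-++⁺ʳ; ∈-++⁻)
open import Data.List.Relation.Binary.Disjoint.Propositional using (Disjoint)
open import Data.List.Relation.Binary.Pointwise as Pointwise using ([]; _∷_)
open import Data.List.Relation.Binary.Subset.Propositional using (_⊆_)
open import Data.List.Relation.Binary.Subset.Propositional.Properties using (xs⊆xs++ys; xs⊆ys++xs; ++⁺ʳ)
open import Data.List.Relation.Unary.All as All using (All; []; _∷_)
import Data.List.Relation.Unary.All.Properties as All
open import Data.List.Relation.Unary.AllPairs using (AllPairs; []; _∷_)
open import Data.List.Relation.Unary.Any as Any using (here; there; any?)
import Data.List.Relation.Unary.Any.Properties as Any
open import Data.List.Relation.Unary.Linked using (Linked)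
import Data.List.Relation.Unary.Linked.Properties as Linked
open import Data.List.Relation.Unary.Linked.Properties using (Linked⇒AllPairs; AllPairs⇒Linked)
open import Data.Product using (∃; _×_; _,_; proj₁; proj₂)
open import Data.Sum using (_⊎_; inj₁; inj₂)
open import Data.Unit using (⊤; tt)
open import Function using (_∘_; flip′; _⇔_; mk⇔; Equivalence)
import Function.Properties.Equivalence as ⇔
open import Relation.Binary.PropositionalEquality
  using (_≡_; refl; sym; trans; cong; cong₂; subst; subst₂; module ≡-Reasoning)
open import Relation.Binary.Structures using (IsTotalOrder)
open import Relation.Nullary using (¬_; Dec; yes; no)
open import Relation.Nullary.Decidable using (decidable-stable)
import Relation.Unary as U

Agree : List Atom → List Atom → List Atom → Set
Agree Γ σ σ' = ∀ {a} → a ∈ Γ → a ∈ σ ⇔ a ∈ σ'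

module _ {A : Set} (Q : A → Set) where

  data Last : List A → Set where
    []   : Last []
    last : ∀ {x} → Q x → Last [ x ]
    _∷_  : ∀ {y xs} x → Last (y ∷ xs) → Last (x ∷ y ∷ xs)

  Last-tail : ∀ {x xs} → Last (x ∷ xs) → Last xs
  Last-tail (last _) = []
  Last-tail (_ ∷ h)  = h

  Last-∷ : ∀ {x xs} → (xs ≡ [] → Q x) → Last xs → Last (x ∷ xs)
  Last-∷ q []         = last (q refl)
  Last-∷ _ h@(last _) = _ ∷ h
  Last-∷ _ h@(_ ∷ _)  = _ ∷ h

  Last⁺ : ∀ xs → (∀ {ys x} → xs ≡ ys ++ [ x ] → Q x) → Last xs
  Last⁺ []           _ = []
  Last⁺ (x ∷ [])     h = last (h {[]} refl)
  Last⁺ (x ∷ y ∷ xs) h = x ∷ Last⁺ (y ∷ xs) (λ {ys} eq → h {x ∷ ys} (cong (x ∷_) eq))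

  Last⁻ : ∀ {xs} → Last xs → ∀ {ys x} → xs ≡ ys ++ [ x ] → Q x
  Last⁻ (last q) {[]}         refl = q
  Last⁻ (_ ∷ h)  {_ ∷ []}     refl = Last⁻ h {[]} refl
  Last⁻ (_ ∷ h)  {_ ∷ y ∷ ys} refl = Last⁻ h {y ∷ ys} refl

  module _ {P : A → Set} (P? : U.Decidable P) (Q⇒P : ∀ {x} → Q x → P x) where

    Last-∷-filter⁺ : ∀ {z} xs → Last (z ∷ xs) → Last (z ∷ filter P? xs)
    Last-∷-filter⁺ []       h = h
    Last-∷-filter⁺ (x ∷ xs) (_ ∷ h) with P? x
    ... | yes _  = _ ∷ Last-∷-filter⁺ xs h
    ... | no ¬px =
      Last-∷-filter⁺ xs (Last-∷ (λ { refl → ⊥-elim (¬px (Q⇒P (last-of h))) }) (Last-tail h))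
      where
      last-of : ∀ {x} → Last [ x ] → Q x
      last-of (last q) = q

    Last-filter⁺ : ∀ xs → Last xs → Last (filter P? xs)
    Last-filter⁺ []       _ = []
    Last-filter⁺ (x ∷ xs) h with P? x
    ... | yes _ = Last-∷-filter⁺ xs h
    ... | no _  = Last-tail (Last-∷-filter⁺ xs h)

Last-map⁺ : ∀ {A B : Set} {P : A → Set} {Q : B → Set} (f : A → B) → (∀ {x} → P x → Q (f x)) →
            ∀ {xs} → Last P xs → Last Q (map f xs)
Last-map⁺ f P⇒Q []       = []
Last-map⁺ f P⇒Q (last p) = last (P⇒Q p)
Last-map⁺ f P⇒Q (x ∷ h)  = f x ∷ Last-map⁺ f P⇒Q h

module _ (R : Reals) where
  open Reals R
  open Semantics R

  ⊨-∧⁺ : ∀ ρ {φ ψ} → ρ ⊨ φ → ρ ⊨ ψ → ρ ⊨ (φ ∧' ψ)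
  ⊨-∧⁺ (_ ∷ _) ⊨φ ⊨ψ = ⊨φ , ⊨ψ

  ⊨-∧⁻ : ∀ ρ {φ ψ} → ρ ⊨ (φ ∧' ψ) → ρ ⊨ φ × ρ ⊨ ψ
  ⊨-∧⁻ (_ ∷ _) ⊨φ∧ψ = ⊨φ∧ψ

  Active : List Atom → Letter × Time → Set
  Active Γ = Intersects Γ ∘ proj₁

  intersects-mono : ∀ {Γ Δ σ} → Γ ⊆ Δ → Intersects Γ σ → Intersects Δ σ
  intersects-mono Γ⊆Δ = Any.map Γ⊆Δ

  agree-intersects : ∀ {Γ σ σ'} → Agree Γ σ σ' → Intersects Γ σ → Intersects Γ σ'
  agree-intersects σ≈σ' q = let a , a∈σ , a∈Γ = find q in lose (Equivalence.to (σ≈σ' a∈Γ) a∈σ) a∈Γ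

  intersects⇒sat-act : ∀ Γ {ρ i} → Intersects Γ (letterAt ρ i) → sat ρ i (act Γ)
  intersects⇒sat-act Γ q = let a , a∈σ , a∈Γ = find q in go a∈Γ a∈σ
    where
    go : ∀ {Γ ρ i a} → a ∈ Γ → a ∈ letterAt ρ i → sat ρ i (act Γ)
    go (here refl) a∈σ (a∉σ , _) = a∉σ a∈σ
    go (there a∈Γ) a∈σ (_ , ¬act) = ¬act (go a∈Γ a∈σ)

  ¬intersects⇒¬sat-act : ∀ Γ {ρ i} → ¬ Intersects Γ (letterAt ρ i) → ¬ sat ρ i (act Γ)
  ¬intersects⇒¬sat-act [] _ s = s tt
  ¬intersects⇒¬sat-act (a ∷ Γ) ¬q s =
    s ((λ a∈σ → ¬q (lose a∈σ (here refl))) , ¬intersects⇒¬sat-act Γ (¬q ∘ intersects-mono there))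

  sat-act⇒intersects : ∀ Γ {ρ i} → sat ρ i (act Γ) → Intersects Γ (letterAt ρ i)
  sat-act⇒intersects Γ s = decidable-stable (any? (_∈? Γ) _) (λ ¬q → ¬intersects⇒¬sat-act Γ ¬q s)

  record Correspondence (Γ : List Atom) (A B : TimedWord) : Set₁ where
    field
      _∼_     : Fin (length A) → Fin (length B) → Set
      activeˡ : ∀ {i j} → i ∼ j → Intersects Γ (letterAt A i)
      activeʳ : ∀ {i j} → i ∼ j → Intersects Γ (letterAt B j)
      agree   : ∀ {i j} → i ∼ j → Agree Γ (letterAt A i) (letterAt B j)
      time    : ∀ {i j} → i ∼ j → timeAt A i ≡ timeAt B j
      totalˡ  : ∀ i → Intersects Γ (letterAt A i) → ∃ λ j → i ∼ j
      totalʳ  : ∀ j → Intersects Γ (letterAt B j) → ∃ λ i → i ∼ j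
      mono    : ∀ {i j i' j'} → i ∼ j → i' ∼ j' → i Fin.< i' → j Fin.< j'
      mono⁻   : ∀ {i j i' j'} → i ∼ j → i' ∼ j' → j Fin.< j' → i Fin.< i'

  converse : ∀ {Γ A B} → Correspondence Γ A B → Correspondence Γ B A
  converse C = record
    { _∼_ = λ j i → i ∼ j
    ; activeˡ = activeʳ ; activeʳ = activeˡ
    ; agree = λ i∼j a∈Γ → ⇔.sym (agree i∼j a∈Γ)
    ; time = sym ∘ time
    ; totalˡ = totalʳ ; totalʳ = totalˡ
    ; mono = mono⁻ ; mono⁻ = mono }
    where open Correspondence C

  module _ {Γ A B} (C : Correspondence Γ A B) {χ : Formula}
           (transfer : ∀ {i j} → Correspondence._∼_ C i j → sat A i χ → sat B j χ) where
    open Correspondence C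

    ∧act-transfer : ∀ {i} → sat A i (χ ∧' act Γ) → ∃ λ j → i ∼ j × sat B j (χ ∧' act Γ)
    ∧act-transfer (s , a) =
      let j , i∼j = totalˡ _ (sat-act⇒intersects Γ a)
      in j , i∼j , transfer i∼j s , intersects⇒sat-act Γ (activeʳ i∼j)

    guard-transfer : ∀ {i₀ j₀ i₁ j₁} → i₀ ∼ j₀ → i₁ ∼ j₁ →
      (∀ k → i₀ Fin.< k → k Fin.< i₁ → sat A k (act Γ ⇒' χ)) →
      (∀ k → j₀ Fin.< k → k Fin.< j₁ → sat B k (act Γ ⇒' χ))
    guard-transfer i₀∼j₀ i₁∼j₁ guard k' j₀<k' k'<j₁ (a , ¬χ) =
      let k , k∼k' = totalʳ k' (sat-act⇒intersects Γ a)
      in guard k (mono⁻ i₀∼j₀ k∼k' j₀<k') (mono⁻ k∼k' i₁∼j₁ k'<j₁)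
               (intersects⇒sat-act Γ (activeˡ k∼k') , ¬χ ∘ transfer k∼k')

  onf-transfer : ∀ {Γ A B} (C : Correspondence Γ A B) φ → BuiltFrom Γ φ →
    ∀ {i j} → Correspondence._∼_ C i j → sat A i (onf Γ φ) → sat B j (onf Γ φ)
  onf-transfer {Γ} C (atom a) a∈Γ i∼j s with a ∈? Γ
  ... | yes _ = Equivalence.to (agree i∼j a∈Γ) (proj₁ s) , intersects⇒sat-act Γ (activeʳ i∼j)
    where open Correspondence C
  ... | no a∉Γ = ⊥-elim (a∉Γ a∈Γ)
  onf-transfer C ttrue _ _ _ = tt
  onf-transfer C (¬' φ) bφ i∼j ¬s s = ¬s (onf-transfer (converse C) φ bφ i∼j s)
  onf-transfer C (φ ∧' ψ) (bφ , bψ) i∼j (sφ , sψ) = onf-transfer C φ bφ i∼j sφ , onf-transfer C ψ bψ i∼j sψ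
  onf-transfer C (U I φ ψ) (bφ , bψ) i∼j (i' , i<i' , i'∈I , sψ , guard) =
    let j' , i'∼j' , sψ' = ∧act-transfer C (onf-transfer C ψ bψ) sψ
    in j' , mono i∼j i'∼j' i<i' , subst (_∈I I) (cong₂ _-_ (time i'∼j') (time i∼j)) i'∈I , sψ' ,
       guard-transfer C (onf-transfer C φ bφ) i∼j i'∼j' guard
    where open Correspondence C
  onf-transfer C (S I φ ψ) (bφ , bψ) i∼j (i' , i'<i , i'∈I , sψ , guard) =
    let j' , i'∼j' , sψ' = ∧act-transfer C (onf-transfer C ψ bψ) sψ
    in j' , mono i'∼j' i∼j i'<i , subst (_∈I I) (cong₂ _-_ (time i∼j) (time i'∼j')) i'∈I , sψ' ,
       guard-transfer C (onf-transfer C φ bφ) i'∼j' i∼j guard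
    where open Correspondence C

  ONF-transfer : ∀ {Γ x y A B} (C : Correspondence Γ (x ∷ A) (y ∷ B)) → Correspondence._∼_ C zero zero →
    ∀ ψ → BuiltFrom Γ ψ → (x ∷ A) ⊨ ONF Γ ψ → (y ∷ B) ⊨ ONF Γ ψ
  ONF-transfer {Γ} C 0∼0 ψ bψ (s , _) = onf-transfer C ψ bψ 0∼0 s , act₀ , λ (_ , ¬act₀) → ¬act₀ act₀
    where act₀ = intersects⇒sat-act Γ (Correspondence.activeʳ C 0∼0)

  data Aligned (Γ : List Atom) : TimedWord → TimedWord → Set where
    []    : Aligned Γ [] []
    skipˡ : ∀ {σ t A B} → ¬ Intersects Γ σ → Aligned Γ A B → Aligned Γ ((σ , t) ∷ A) B
    skipʳ : ∀ {σ t A B} → ¬ Intersects Γ σ → Aligned Γ A B → Aligned Γ A ((σ , t) ∷ B)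
    match : ∀ {σ σ' t A B} → Intersects Γ σ → Agree Γ σ σ' → Aligned Γ A B →
            Aligned Γ ((σ , t) ∷ A) ((σ' , t) ∷ B)

  module _ {Γ : List Atom} where

    Matched : ∀ {A B} → Aligned Γ A B → Fin (length A) → Fin (length B) → Set
    Matched (skipˡ _ al) zero    j       = ⊥
    Matched (skipˡ _ al) (suc i) j       = Matched al i j
    Matched (skipʳ _ al) i       zero    = ⊥
    Matched (skipʳ _ al) i       (suc j) = Matched al i j
    Matched (match _ _ al) zero    zero    = ⊤
    Matched (match _ _ al) zero    (suc j) = ⊥
    Matched (match _ _ al) (suc i) zero    = ⊥
    Matched (match _ _ al) (suc i) (suc j) = Matched al i j

    matched-active : ∀ {A B} (al : Aligned Γ A B) {i j} → Matched al i j → Intersects Γ (letterAt A i)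
    matched-active (skipˡ _ al)   {suc i}         m = matched-active al m
    matched-active (skipʳ _ al)   {i}     {suc j} m = matched-active al m
    matched-active (match q _ al) {zero}  {zero}  _ = q
    matched-active (match _ _ al) {suc i} {suc j} m = matched-active al m

    matched-agree : ∀ {A B} (al : Aligned Γ A B) {i j} → Matched al i j → Agree Γ (letterAt A i) (letterAt B j)
    matched-agree (skipˡ _ al)    {suc i}         m = matched-agree al m
    matched-agree (skipʳ _ al)    {i}     {suc j} m = matched-agree al m
    matched-agree (match _ σ≈ al) {zero}  {zero}  _ = σ≈
    matched-agree (match _ _ al)  {suc i} {suc j} m = matched-agree al m

    matched-time : ∀ {A B} (al : Aligned Γ A B) {i j} → Matched al i j → timeAt A i ≡ timeAt B j
    matched-time (skipˡ _ al)   {suc i}         m = matched-time al m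
    matched-time (skipʳ _ al)   {i}     {suc j} m = matched-time al m
    matched-time (match _ _ al) {zero}  {zero}  _ = refl
    matched-time (match _ _ al) {suc i} {suc j} m = matched-time al m

    matched-totalˡ : ∀ {A B} (al : Aligned Γ A B) i → Intersects Γ (letterAt A i) → ∃ λ j → Matched al i j
    matched-totalˡ (skipˡ ¬q al)  zero    q = ⊥-elim (¬q q)
    matched-totalˡ (skipˡ _ al)   (suc i) q = matched-totalˡ al i q
    matched-totalˡ (skipʳ _ al)   i       q = let j , m = matched-totalˡ al i q in suc j , m
    matched-totalˡ (match _ _ al) zero    q = zero , tt
    matched-totalˡ (match _ _ al) (suc i) q = let j , m = matched-totalˡ al i q in suc j , m

    matched-totalʳ : ∀ {A B} (al : Aligned Γ A B) j → Intersects Γ (letterAt B j) → ∃ λ i → Matched al i j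
    matched-totalʳ (skipʳ ¬q al)  zero    q = ⊥-elim (¬q q)
    matched-totalʳ (skipʳ _ al)   (suc j) q = matched-totalʳ al j q
    matched-totalʳ (skipˡ _ al)   j       q = let i , m = matched-totalʳ al j q in suc i , m
    matched-totalʳ (match _ _ al) zero    q = zero , tt
    matched-totalʳ (match _ _ al) (suc j) q = let i , m = matched-totalʳ al j q in suc i , m

    matched-mono : ∀ {A B} (al : Aligned Γ A B) {i j i' j'} → Matched al i j → Matched al i' j' →
                   i Fin.< i' → j Fin.< j'
    matched-mono (skipˡ _ al)   {suc i} {_}   {suc i'}          m m' (s≤s i<i') = matched-mono al m m' i<i'
    matched-mono (skipʳ _ al)   {_}     {suc j} {_}    {suc j'} m m' i<i'       = s≤s (matched-mono al m m' i<i')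
    matched-mono (match _ _ al) {zero}  {zero}  {suc _} {suc _} _ _  _          = s≤s z≤n
    matched-mono (match _ _ al) {suc i} {suc j} {suc i'} {suc j'} m m' (s≤s i<i') = s≤s (matched-mono al m m' i<i')

    matched-mono⁻ : ∀ {A B} (al : Aligned Γ A B) {i j i' j'} → Matched al i j → Matched al i' j' →
                    j Fin.< j' → i Fin.< i'
    matched-mono⁻ (skipʳ _ al)   {_}     {suc j} {_}    {suc j'} m m' (s≤s j<j') = matched-mono⁻ al m m' j<j'
    matched-mono⁻ (skipˡ _ al)   {suc i} {_}     {suc i'}        m m' j<j'       = s≤s (matched-mono⁻ al m m' j<j')
    matched-mono⁻ (match _ _ al) {zero}  {zero}  {suc _} {suc _} _ _  _          = s≤s z≤n
    matched-mono⁻ (match _ _ al) {suc i} {suc j} {suc i'} {suc j'} m m' (s≤s j<j') = s≤s (matched-mono⁻ al m m' j<j')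

    correspondence : ∀ {A B} → Aligned Γ A B → Correspondence Γ A B
    correspondence al = record
      { _∼_ = Matched al
      ; activeˡ = matched-active al
      ; activeʳ = λ m → agree-intersects (matched-agree al m) (matched-active al m)
      ; agree = matched-agree al
      ; time = matched-time al
      ; totalˡ = matched-totalˡ al ; totalʳ = matched-totalʳ al
      ; mono = matched-mono al ; mono⁻ = matched-mono⁻ al }

    aligned-ONF : ∀ {x y A B} → Aligned Γ (x ∷ A) (y ∷ B) → Active Γ x → Active Γ y →
      ∀ ψ → BuiltFrom Γ ψ → (x ∷ A) ⊨ ONF Γ ψ → (y ∷ B) ⊨ ONF Γ ψ
    aligned-ONF al qx qy = ONF-transfer (correspondence al) (heads-matched al qx qy)
      where
      heads-matched : ∀ {x y A B} (al : Aligned Γ (x ∷ A) (y ∷ B)) → Active Γ x → Active Γ y →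
                      Matched al zero zero
      heads-matched (skipˡ ¬qx _) qx _  = ⊥-elim (¬qx qx)
      heads-matched (skipʳ ¬qy _) _  qy = ⊥-elim (¬qy qy)
      heads-matched (match _ _ _) _  _  = tt

  WellFormed : List Atom → Letter × Time → Set
  WellFormed Δ p = ¬ proj₁ p ≡ [] × All (_∈ Δ) (proj₁ p) × 0# ≤ proj₂ p

  _≤ₜ_ : Letter × Time → Letter × Time → Set
  p ≤ₜ q = proj₂ p ≤ proj₂ q

  Sorted : TimedWord → Set
  Sorted = Linked _≤ₜ_

  ≤-trans : ∀ {x y z} → x ≤ y → y ≤ z → x ≤ z
  ≤-trans = IsTotalOrder.trans isTotalOrder

  total : ∀ x y → x ≤ y ⊎ y ≤ x
  total = IsTotalOrder.total isTotalOrder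

  intersects⇒≢[] : ∀ {Γ σ} → Intersects Γ σ → ¬ σ ≡ []
  intersects⇒≢[] (here _)  ()
  intersects⇒≢[] (there _) ()

  filter-agree : ∀ Γ σ → Agree Γ σ (filter (_∈? Γ) σ)
  filter-agree Γ σ a∈Γ = mk⇔ (λ a∈σ → ∈-filter⁺ (_∈? Γ) a∈σ a∈Γ) (proj₁ ∘ ∈-filter⁻ (_∈? Γ))

  intersects-filter : ∀ {Γ Δ σ} → Γ ⊆ Δ → Intersects Γ σ → Intersects Γ (filter (_∈? Δ) σ)
  intersects-filter Γ⊆Δ q = let a , a∈σ , a∈Γ = find q in lose (∈-filter⁺ (_∈? _) a∈σ (Γ⊆Δ a∈Γ)) a∈Γ

  filter-filter : ∀ {Γ Δ} → Γ ⊆ Δ → ∀ σ → filter (_∈? Γ) (filter (_∈? Δ) σ) ≡ filter (_∈? Γ) σ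
  filter-filter Γ⊆Δ [] = refl
  filter-filter {Γ} {Δ} Γ⊆Δ (a ∷ σ) with a ∈? Δ
  ... | yes _ with a ∈? Γ
  ...   | yes _ = cong (a ∷_) (filter-filter Γ⊆Δ σ)
  ...   | no _  = filter-filter Γ⊆Δ σ
  filter-filter {Γ} {Δ} Γ⊆Δ (a ∷ σ) | no a∉Δ with a ∈? Γ
  ...   | yes a∈Γ = ⊥-elim (a∉Δ (Γ⊆Δ a∈Γ))
  ...   | no _    = filter-filter Γ⊆Δ σ

  project-active : ∀ Γ {σ t ρ} → Intersects Γ σ →
    project Γ ((σ , t) ∷ ρ) ≡ (filter (_∈? Γ) σ , t) ∷ project Γ ρ
  project-active Γ q = cong (map _) (filter-accept (λ p → any? (_∈? Γ) (proj₁ p)) q)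

  project-inactive : ∀ Γ {σ t ρ} → ¬ Intersects Γ σ → project Γ ((σ , t) ∷ ρ) ≡ project Γ ρ
  project-inactive Γ ¬q = cong (map _) (filter-reject (λ p → any? (_∈? Γ) (proj₁ p)) ¬q)

  project-project : ∀ {Γ Δ} → Γ ⊆ Δ → ∀ ρ → project Γ (project Δ ρ) ≡ project Γ ρ
  project-project Γ⊆Δ [] = refl
  project-project {Γ} {Δ} Γ⊆Δ ((σ , t) ∷ ρ) = by-activity (any? (_∈? Δ) σ) (any? (_∈? Γ) σ)
    where
    open ≡-Reasoning
    intersects-filter⁻ : Intersects Γ (filter (_∈? Δ) σ) → Intersects Γ σ
    intersects-filter⁻ q = let a , a∈σ' , a∈Γ = find q in lose (proj₁ (∈-filter⁻ (_∈? Δ) a∈σ')) a∈Γ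
    by-activity : Dec (Intersects Δ σ) → Dec (Intersects Γ σ) →
                  project Γ (project Δ ((σ , t) ∷ ρ)) ≡ project Γ ((σ , t) ∷ ρ)
    by-activity (yes qΔ) (yes qΓ) = begin
      project Γ (project Δ ((σ , t) ∷ ρ))                ≡⟨ cong (project Γ) (project-active Δ qΔ) ⟩
      project Γ ((filter (_∈? Δ) σ , t) ∷ project Δ ρ)   ≡⟨ project-active Γ (intersects-filter Γ⊆Δ qΓ) ⟩
      (filter (_∈? Γ) (filter (_∈? Δ) σ) , t) ∷ project Γ (project Δ ρ)
        ≡⟨ cong₂ (λ σ' ρ' → (σ' , t) ∷ ρ') (filter-filter Γ⊆Δ σ) (project-project Γ⊆Δ ρ) ⟩
      (filter (_∈? Γ) σ , t) ∷ project Γ ρ               ≡⟨ project-active Γ qΓ ⟨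
      project Γ ((σ , t) ∷ ρ)                            ∎
    by-activity (yes qΔ) (no ¬qΓ) = begin
      project Γ (project Δ ((σ , t) ∷ ρ))                ≡⟨ cong (project Γ) (project-active Δ qΔ) ⟩
      project Γ ((filter (_∈? Δ) σ , t) ∷ project Δ ρ)   ≡⟨ project-inactive Γ (¬qΓ ∘ intersects-filter⁻) ⟩
      project Γ (project Δ ρ)                            ≡⟨ project-project Γ⊆Δ ρ ⟩
      project Γ ρ                                        ≡⟨ project-inactive Γ ¬qΓ ⟨
      project Γ ((σ , t) ∷ ρ)                            ∎
    by-activity (no ¬qΔ) (yes qΓ) = ⊥-elim (¬qΔ (intersects-mono Γ⊆Δ qΓ))
    by-activity (no ¬qΔ) (no ¬qΓ) = begin
      project Γ (project Δ ((σ , t) ∷ ρ))                ≡⟨ cong (project Γ) (project-inactive Δ ¬qΔ) ⟩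
      project Γ (project Δ ρ)                            ≡⟨ project-project Γ⊆Δ ρ ⟩
      project Γ ρ                                        ≡⟨ project-inactive Γ ¬qΓ ⟨
      project Γ ((σ , t) ∷ ρ)                            ∎

  aligned-project : ∀ Γ ρ → Aligned Γ ρ (project Γ ρ)
  aligned-project Γ [] = []
  aligned-project Γ ((σ , t) ∷ ρ) with any? (_∈? Γ) σ
  ... | yes q = match q (filter-agree Γ σ) (aligned-project Γ ρ)
  ... | no ¬q = skipˡ ¬q (aligned-project Γ ρ)

  project-wellFormed : ∀ Γ {Δ ρ} → All (WellFormed Δ) ρ → All (WellFormed Γ) (project Γ ρ)
  project-wellFormed Γ {ρ = ρ} wf =
    All.map⁺ (All.zipWith restrict (All.all-filter (λ p → any? (_∈? Γ) (proj₁ p)) ρ , All.filter⁺ _ wf))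
    where
    restrict : ∀ {Δ p} → Active Γ p × WellFormed Δ p → WellFormed Γ (filter (_∈? Γ) (proj₁ p) , proj₂ p)
    restrict {p = σ , _} (q , _ , _ , 0≤t) =
      intersects⇒≢[] (agree-intersects (filter-agree Γ σ) q) , All.all-filter (_∈? Γ) σ , 0≤t

  project-sorted : ∀ Γ {ρ} → Sorted ρ → Sorted (project Γ ρ)
  project-sorted Γ = Linked.map⁺ ∘ Linked.filter⁺ (λ p → any? (_∈? Γ) (proj₁ p)) ≤-trans

  project-Last : ∀ {Sig Γ} → Sig ⊆ Γ → ∀ ρ → Last (Active Sig) ρ → Last (Active Sig) (project Γ ρ)
  project-Last {Sig} {Γ} Sig⊆Γ ρ =
    Last-map⁺ {P = Active Sig} {Q = Active Sig} (λ p → filter (_∈? Γ) (proj₁ p) , proj₂ p)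
      (λ {p} → intersects-filter {σ = proj₁ p} Sig⊆Γ) ∘
    Last-filter⁺ (Active Sig) (λ p → any? (_∈? Γ) (proj₁ p)) (intersects-mono Sig⊆Γ) ρ

  project-oversampled : ∀ Sig X Y {ρ} → Oversampled Sig X ρ → Oversampled Sig Y (project (Sig ++ Y) ρ)
  project-oversampled Sig X Y {[]} ((ρ≢[] , _) , _) = ⊥-elim (ρ≢[] refl)
  project-oversampled Sig X Y {ρ@((σ , t) ∷ _)} ((_ , wf , sorted) , first , final) =
    (projection≢[] , project-wellFormed Γ wf , project-sorted Γ sorted) , first' ,
    Last⁻ (Active Sig) (project-Last ∈-++⁺ˡ ρ (Last⁺ (Active Sig) ρ final))
    where
    Γ = Sig ++ Y
    head-kept : project Γ ρ ≡ (filter (_∈? Γ) σ , t) ∷ _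
    head-kept = project-active Γ (intersects-mono ∈-++⁺ˡ (first refl))
    projection≢[] : ¬ project Γ ρ ≡ []
    projection≢[] eq with trans (sym head-kept) eq
    ... | ()
    first' : ∀ {σ' t' ρ'} → project Γ ρ ≡ (σ' , t') ∷ ρ' → Intersects Sig σ'
    first' eq with trans (sym head-kept) eq
    ... | refl = intersects-filter ∈-++⁺ˡ (first refl)

  EquiSat-ONF-sound : ∀ Sig X Y {φ} ψ → BuiltFrom (Sig ++ Y) ψ → EquiSat Sig Y φ (ONF (Sig ++ Y) ψ) →
    ∀ {ρ} → Oversampled Sig X ρ → ρ ⊨ ONF (Sig ++ Y) ψ → project Sig ρ ⊨ φ
  EquiSat-ONF-sound Sig X Y {φ} ψ bψ (sound , _) {ρ@((σ , t) ∷ _)} ov ρ⊨ζ =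
    subst (_⊨ φ) (project-project ∈-++⁺ˡ ρ) (sound _ (project-oversampled Sig X Y ov) projection⊨ζ)
    where
    Γ = Sig ++ Y
    q : Intersects Γ σ
    q = intersects-mono ∈-++⁺ˡ (proj₁ (proj₂ ov) refl)
    projection⊨ζ : project Γ ρ ⊨ ONF Γ ψ
    projection⊨ζ = subst (_⊨ ONF Γ ψ) (sym (project-active Γ q))
      (aligned-ONF (subst (Aligned Γ ρ) (project-active Γ q) (aligned-project Γ ρ))
                   q (agree-intersects (filter-agree Γ σ) q) ψ bψ ρ⊨ζ)

  ≈W-refl : ∀ {ρ} → ρ ≈W ρ
  ≈W-refl {[]}    = []
  ≈W-refl {_ ∷ _} = ((λ _ → ⇔.refl) , refl) ∷ ≈W-refl

  ≈W-sym : ∀ {ρ ρ'} → ρ ≈W ρ' → ρ' ≈W ρ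
  ≈W-sym = Pointwise.symmetric λ (σ≈σ' , t≡t') → (λ a → ⇔.sym (σ≈σ' a)) , sym t≡t'

  ≈W-trans : ∀ {ρ ρ' ρ''} → ρ ≈W ρ' → ρ' ≈W ρ'' → ρ ≈W ρ''
  ≈W-trans = Pointwise.transitive λ (σ≈ , t≡) (σ≈' , t≡') →
    (λ a → ⇔.trans (σ≈ a) (σ≈' a)) , trans t≡ t≡'

  Above : Time → Letter × Time → Set
  Above u p = u ≤ proj₂ p

  ≈W-Above : ∀ {u ρ ρ'} → ρ ≈W ρ' → All (Above u) ρ → All (Above u) ρ'
  ≈W-Above []                 []       = []
  ≈W-Above ((_ , t≡t') ∷ ρ≈ρ') (b ∷ bs) = subst (_ ≤_) t≡t' b ∷ ≈W-Above ρ≈ρ' bs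

  project-Above : ∀ Γ {u ρ} → All (Above u) ρ → All (Above u) (project Γ ρ)
  project-Above Γ = All.map⁺ ∘ All.filter⁺ (λ p → any? (_∈? Γ) (proj₁ p))

  agree⇒filter-≈ : ∀ {Γ σ σ'} → Agree Γ σ σ' → ∀ a → a ∈ filter (_∈? Γ) σ ⇔ a ∈ filter (_∈? Γ) σ'
  agree⇒filter-≈ {Γ} σ≈σ' a = mk⇔ (transport σ≈σ') (transport (⇔.sym ∘ σ≈σ'))
    where
    transport : ∀ {σ σ'} → Agree Γ σ σ' → a ∈ filter (_∈? Γ) σ → a ∈ filter (_∈? Γ) σ'
    transport σ≈σ' a∈ =
      let a∈σ , a∈Γ = ∈-filter⁻ (_∈? Γ) a∈ in ∈-filter⁺ (_∈? Γ) (Equivalence.to (σ≈σ' a∈Γ) a∈σ) a∈Γ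

  filter-≈⇒agree : ∀ {Γ σ σ'} → (∀ a → a ∈ filter (_∈? Γ) σ ⇔ a ∈ filter (_∈? Γ) σ') → Agree Γ σ σ'
  filter-≈⇒agree {Γ} {σ} {σ'} σ≈σ' {a} a∈Γ =
    ⇔.trans (filter-agree Γ σ a∈Γ) (⇔.trans (σ≈σ' a) (⇔.sym (filter-agree Γ σ' a∈Γ)))

  agree-++ˡ : ∀ {Sig Γ σ σ'} → Agree Sig σ σ' → (∀ {a} → a ∈ Γ → a ∈ σ' → a ∈ Sig) →
              Agree Γ (σ ++ σ') σ
  agree-++ˡ {σ = σ} σ≈σ' σ∩Γ⊆Sig a∈Γ = mk⇔ from-++ ∈-++⁺ˡ
    where
    from-++ : _ ∈ σ ++ _ → _ ∈ σ
    from-++ a∈ with ∈-++⁻ σ a∈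
    ... | inj₁ a∈σ  = a∈σ
    ... | inj₂ a∈σ' = Equivalence.from (σ≈σ' (σ∩Γ⊆Sig a∈Γ a∈σ')) a∈σ'

  agree-++ʳ : ∀ {Sig Γ σ σ'} → Agree Sig σ σ' → (∀ {a} → a ∈ Γ → a ∈ σ → a ∈ Sig) →
              Agree Γ (σ ++ σ') σ'
  agree-++ʳ {σ = σ} σ≈σ' σ∩Γ⊆Sig a∈Γ = mk⇔ from-++ (∈-++⁺ʳ σ)
    where
    from-++ : _ ∈ σ ++ _ → _ ∈ _
    from-++ a∈ with ∈-++⁻ σ a∈
    ... | inj₁ a∈σ  = Equivalence.to (σ≈σ' (σ∩Γ⊆Sig a∈Γ a∈σ)) a∈σ
    ... | inj₂ a∈σ' = a∈σ'

  module _ (Sig : List Atom) where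

    Inactive : Letter × Time → Set
    Inactive = ¬_ ∘ Active Sig

    data Merge : TimedWord → TimedWord → TimedWord → Set where
      []ˡ   : ∀ {ys} → All Inactive ys → Merge [] ys ys
      []ʳ   : ∀ {xs} → All Inactive xs → Merge xs [] xs
      both  : ∀ {σ σ' t t' xs ys o} → Intersects Sig σ → Agree Sig σ σ' → t ≡ t' → Merge xs ys o →
              Merge ((σ , t) ∷ xs) ((σ' , t') ∷ ys) ((σ ++ σ' , t) ∷ o)
      takeˡ : ∀ {x y xs ys o} → Inactive x → x ≤ₜ y → Merge xs (y ∷ ys) o → Merge (x ∷ xs) (y ∷ ys) (x ∷ o)
      takeʳ : ∀ {x y xs ys o} → Inactive y → y ≤ₜ x → Merge (x ∷ xs) ys o → Merge (x ∷ xs) (y ∷ ys) (y ∷ o)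

    project≈[]⇒inactive : ∀ ρ → project Sig ρ ≈W [] → All Inactive ρ
    project≈[]⇒inactive [] _ = []
    project≈[]⇒inactive ((σ , t) ∷ ρ) al with any? (_∈? Sig) σ
    project≈[]⇒inactive ((σ , t) ∷ ρ) ()  | yes _
    project≈[]⇒inactive ((σ , t) ∷ ρ) al  | no ¬q = ¬q ∷ project≈[]⇒inactive ρ al

    merge-exists : ∀ xs ys → AllPairs _≤ₜ_ xs → AllPairs _≤ₜ_ ys → project Sig xs ≈W project Sig ys →
                   ∃ (Merge xs ys)
    merge-exists [] ys _ _ xs≈ys = ys , []ˡ (project≈[]⇒inactive ys (≈W-sym xs≈ys))
    merge-exists xs [] _ _ xs≈ys = xs , []ʳ (project≈[]⇒inactive xs xs≈ys)
    -- Abstracting the activity tests also unfolds both projections in xs≈ys.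
    merge-exists (x ∷ xs) (y ∷ ys) sx sy xs≈ys
      with any? (_∈? Sig) (proj₁ x) | any? (_∈? Sig) (proj₁ y) | total (proj₂ x) (proj₂ y)
    merge-exists (x ∷ xs) (y ∷ ys) (_ ∷ sx) (_ ∷ sy) ((σ≈σ' , t≡t') ∷ xs≈ys) | yes q | yes _ | _ =
      let o , M = merge-exists xs ys sx sy xs≈ys in _ , both q (filter-≈⇒agree σ≈σ') t≡t' M
    merge-exists (x ∷ xs) (y ∷ ys) sx (y≤ys ∷ sy) xs≈ys | yes q | no ¬q' | _ =
      let o , M = merge-exists (x ∷ xs) ys sx sy (subst (_≈W _) (sym (project-active Sig q)) xs≈ys)
      in _ , takeʳ ¬q' (All.head (≈W-Above (≈W-sym xs≈ys) (project-Above Sig y≤ys))) M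
    merge-exists (x ∷ xs) (y ∷ ys) (x≤xs ∷ sx) sy xs≈ys | no ¬q | yes q' | _ =
      let o , M = merge-exists xs (y ∷ ys) sx sy (subst (_ ≈W_) (sym (project-active Sig q')) xs≈ys)
      in _ , takeˡ ¬q (All.head (≈W-Above xs≈ys (project-Above Sig x≤xs))) M
    merge-exists (x ∷ xs) (y ∷ ys) (_ ∷ sx) sy xs≈ys | no ¬q | no ¬q' | inj₁ x≤y =
      let o , M = merge-exists xs (y ∷ ys) sx sy (subst (_ ≈W_) (sym (project-inactive Sig ¬q')) xs≈ys)
      in _ , takeˡ ¬q x≤y M
    merge-exists (x ∷ xs) (y ∷ ys) sx (_ ∷ sy) xs≈ys | no ¬q | no ¬q' | inj₂ y≤x =
      let o , M = merge-exists (x ∷ xs) ys sx sy (subst (_≈W _) (sym (project-inactive Sig ¬q)) xs≈ys)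
      in _ , takeʳ ¬q' y≤x M

    merge-All : ∀ {P : Letter × Time → Set} → (∀ {σ σ' t t'} → P (σ , t) → P (σ' , t') → P (σ ++ σ' , t)) →
                ∀ {xs ys o} → Merge xs ys o → All P xs → All P ys → All P o
    merge-All fuse ([]ˡ _)       _          pys        = pys
    merge-All fuse ([]ʳ _)       pxs        _          = pxs
    merge-All fuse (both _ _ _ M) (px ∷ pxs) (py ∷ pys) = fuse px py ∷ merge-All fuse M pxs pys
    merge-All fuse (takeˡ _ _ M) (px ∷ pxs) pys        = px ∷ merge-All fuse M pxs pys
    merge-All fuse (takeʳ _ _ M) pxs        (py ∷ pys) = py ∷ merge-All fuse M pxs pys

    merge-sorted : ∀ {xs ys o} → Merge xs ys o → AllPairs _≤ₜ_ xs → AllPairs _≤ₜ_ ys → AllPairs _≤ₜ_ o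
    merge-sorted ([]ˡ _) _ sy = sy
    merge-sorted ([]ʳ _) sx _ = sx
    merge-sorted (both _ _ refl M) (x≤xs ∷ sx) (y≤ys ∷ sy) =
      merge-All (λ b _ → b) M x≤xs y≤ys ∷ merge-sorted M sx sy
    merge-sorted (takeˡ _ x≤y M) (x≤xs ∷ sx) sy@(y≤ys ∷ _) =
      merge-All (λ b _ → b) M x≤xs (x≤y ∷ All.map (≤-trans x≤y) y≤ys) ∷ merge-sorted M sx sy
    merge-sorted (takeʳ _ y≤x M) sx@(x≤xs ∷ _) (y≤ys ∷ sy) =
      merge-All (λ b _ → b) M (y≤x ∷ All.map (≤-trans y≤x) x≤xs) y≤ys ∷ merge-sorted M sx sy

    merge-≢[]ˡ : ∀ {x xs ys o} → Merge (x ∷ xs) ys o → ¬ o ≡ []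
    merge-≢[]ˡ ([]ʳ _)        ()
    merge-≢[]ˡ (both _ _ _ _) ()
    merge-≢[]ˡ (takeˡ _ _ _)  ()
    merge-≢[]ˡ (takeʳ _ _ _)  ()

    merge-≢[]ʳ : ∀ {xs y ys o} → Merge xs (y ∷ ys) o → ¬ o ≡ []
    merge-≢[]ʳ ([]ˡ _)        ()
    merge-≢[]ʳ (both _ _ _ _) ()
    merge-≢[]ʳ (takeˡ _ _ _)  ()
    merge-≢[]ʳ (takeʳ _ _ _)  ()

    merge-Last : ∀ {xs ys o} → Merge xs ys o → Last (Active Sig) xs → Last (Active Sig) ys → Last (Active Sig) o
    merge-Last ([]ˡ _) _ ly = ly
    merge-Last ([]ʳ _) lx _ = lx
    merge-Last (both q _ _ M) lx ly =
      Last-∷ (Active Sig) (λ _ → Any.++⁺ˡ q) (merge-Last M (Last-tail _ lx) (Last-tail _ ly))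
    merge-Last (takeˡ _ _ M) lx ly =
      Last-∷ (Active Sig) (⊥-elim ∘ merge-≢[]ʳ M) (merge-Last M (Last-tail _ lx) ly)
    merge-Last (takeʳ _ _ M) lx ly =
      Last-∷ (Active Sig) (⊥-elim ∘ merge-≢[]ˡ M) (merge-Last M lx (Last-tail _ ly))

    project-inactives : ∀ {ρ} → All Inactive ρ → project Sig ρ ≡ []
    project-inactives inactive = cong (map _) (filter-none (λ p → any? (_∈? Sig) (proj₁ p)) inactive)

    merge-project : ∀ {xs ys o} → Merge xs ys o → project Sig o ≈W project Sig xs
    merge-project ([]ˡ inactive) = subst (_≈W []) (sym (project-inactives inactive)) []
    merge-project ([]ʳ _) = ≈W-refl
    merge-project (both q σ≈σ' refl M) =
      subst₂ _≈W_ (sym (project-active Sig (Any.++⁺ˡ q))) (sym (project-active Sig q))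
        ((agree⇒filter-≈ (agree-++ˡ σ≈σ' (λ a∈Sig _ → a∈Sig)) , refl) ∷ merge-project M)
    merge-project (takeˡ ¬q _ M) =
      subst₂ _≈W_ (sym (project-inactive Sig ¬q)) (sym (project-inactive Sig ¬q)) (merge-project M)
    merge-project (takeʳ ¬q _ M) = subst (_≈W _) (sym (project-inactive Sig ¬q)) (merge-project M)

  wellFormed-active : ∀ {Γ p} → WellFormed Γ p → Active Γ p
  wellFormed-active {p = [] , _}    (σ≢[] , _)          = ⊥-elim (σ≢[] refl)
  wellFormed-active {p = _ ∷ _ , _} (_ , a∈Γ ∷ _ , _)   = here a∈Γ

  wellFormed-mono : ∀ {Γ Δ p} → Γ ⊆ Δ → WellFormed Γ p → WellFormed Δ p
  wellFormed-mono Γ⊆Δ (σ≢[] , σ⊆Γ , 0≤t) = σ≢[] , All.map Γ⊆Δ σ⊆Γ , 0≤t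

  wellFormed-++ : ∀ {Γ σ σ' t t'} → WellFormed Γ (σ , t) → WellFormed Γ (σ' , t') → WellFormed Γ (σ ++ σ' , t)
  wellFormed-++ {σ = σ} {σ'} (σ≢[] , σ⊆Γ , 0≤t) (_ , σ'⊆Γ , _) =
    σ≢[] ∘ ++-conicalˡ σ σ' , All.++⁺ σ⊆Γ σ'⊆Γ , 0≤t

  aligned-refl : ∀ {Γ ρ} → All (WellFormed Γ) ρ → Aligned Γ ρ ρ
  aligned-refl []         = []
  aligned-refl (w ∷ wf) = match (wellFormed-active w) (λ _ → ⇔.refl) (aligned-refl wf)

  module _ {Sig Γ Δ : List Atom} (Γ∩Δ⊆Sig : ∀ {a} → a ∈ Γ → a ∈ Δ → a ∈ Sig) where

    invisible : ∀ {σ} → ¬ Intersects Sig σ → All (_∈ Δ) σ → ¬ Intersects Γ σ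
    invisible ¬q σ⊆Δ q =
      let a , a∈σ , a∈Γ = find q in ¬q (lose a∈σ (Γ∩Δ⊆Sig a∈Γ (All.lookup σ⊆Δ a∈σ)))

    aligned-[] : ∀ {ys} → All (Inactive Sig) ys → All (WellFormed Δ) ys → Aligned Γ [] ys
    aligned-[] []              []                     = []
    aligned-[] (¬q ∷ inactive) ((_ , σ⊆Δ , _) ∷ wf) = skipʳ (invisible ¬q σ⊆Δ) (aligned-[] inactive wf)

    merge-alignedˡ : ∀ {xs ys o} → Merge Sig xs ys o → All (WellFormed Γ) xs → All (WellFormed Δ) ys → Aligned Γ xs o
    merge-alignedˡ ([]ˡ inactive) _ wfy = aligned-[] inactive wfy
    merge-alignedˡ ([]ʳ _) wfx _ = aligned-refl wfx
    merge-alignedˡ (both _ σ≈σ' refl M) (w ∷ wfx) ((_ , σ'⊆Δ , _) ∷ wfy) =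
      match (wellFormed-active w) (⇔.sym ∘ agree-++ˡ σ≈σ' (λ a∈Γ → Γ∩Δ⊆Sig a∈Γ ∘ All.lookup σ'⊆Δ))
            (merge-alignedˡ M wfx wfy)
    merge-alignedˡ (takeˡ _ _ M) (w ∷ wfx) wfy = match (wellFormed-active w) (λ _ → ⇔.refl) (merge-alignedˡ M wfx wfy)
    merge-alignedˡ (takeʳ ¬q _ M) wfx ((_ , σ⊆Δ , _) ∷ wfy) = skipʳ (invisible ¬q σ⊆Δ) (merge-alignedˡ M wfx wfy)

  merge-alignedʳ : ∀ {Sig Γ Δ} → (∀ {a} → a ∈ Γ → a ∈ Δ → a ∈ Sig) →
    ∀ {xs ys o} → Merge Sig xs ys o → All (WellFormed Γ) xs → All (WellFormed Δ) ys → Aligned Δ ys o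
  merge-alignedʳ Γ∩Δ⊆Sig ([]ˡ _) _ wfy = aligned-refl wfy
  merge-alignedʳ Γ∩Δ⊆Sig ([]ʳ inactive) wfx _ = aligned-[] (flip′ Γ∩Δ⊆Sig) inactive wfx
  merge-alignedʳ Γ∩Δ⊆Sig (both _ σ≈σ' refl M) ((_ , σ⊆Γ , _) ∷ wfx) (w ∷ wfy) =
    match (wellFormed-active w) (⇔.sym ∘ agree-++ʳ σ≈σ' (λ a∈Δ a∈σ → Γ∩Δ⊆Sig (All.lookup σ⊆Γ a∈σ) a∈Δ))
          (merge-alignedʳ Γ∩Δ⊆Sig M wfx wfy)
  merge-alignedʳ Γ∩Δ⊆Sig (takeˡ ¬q _ M) ((_ , σ⊆Γ , _) ∷ wfx) wfy =
    skipʳ (invisible (flip′ Γ∩Δ⊆Sig) ¬q σ⊆Γ) (merge-alignedʳ Γ∩Δ⊆Sig M wfx wfy)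
  merge-alignedʳ Γ∩Δ⊆Sig (takeʳ _ _ M) wfx (w ∷ wfy) =
    match (wellFormed-active w) (λ _ → ⇔.refl) (merge-alignedʳ Γ∩Δ⊆Sig M wfx wfy)

  module _ (Sig X₁ X₂ : List Atom) (X₁#X₂ : Disjoint X₁ X₂) where

    Γ₁∩Γ₂⊆Sig : ∀ {a} → a ∈ Sig ++ X₁ → a ∈ Sig ++ X₂ → a ∈ Sig
    Γ₁∩Γ₂⊆Sig a∈Γ₁ a∈Γ₂ with ∈-++⁻ Sig a∈Γ₁ | ∈-++⁻ Sig a∈Γ₂
    ... | inj₁ a∈Sig | _          = a∈Sig
    ... | inj₂ _     | inj₁ a∈Sig = a∈Sig
    ... | inj₂ a∈X₁  | inj₂ a∈X₂  = ⊥-elim (X₁#X₂ (a∈X₁ , a∈X₂))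

    oversampled-merge : ∀ ψ₁ ψ₂ {ρ₁ ρ₂} → BuiltFrom (Sig ++ X₁) ψ₁ → BuiltFrom (Sig ++ X₂) ψ₂ →
      Oversampled Sig X₁ ρ₁ → ρ₁ ⊨ ONF (Sig ++ X₁) ψ₁ →
      Oversampled Sig X₂ ρ₂ → ρ₂ ⊨ ONF (Sig ++ X₂) ψ₂ → project Sig ρ₁ ≈W project Sig ρ₂ →
      ∃ λ ρ → Oversampled Sig (X₁ ++ X₂) ρ × ρ ⊨ (ONF (Sig ++ X₁) ψ₁ ∧' ONF (Sig ++ X₂) ψ₂) ×
              project Sig ρ ≈W project Sig ρ₁
    oversampled-merge _ _ {ρ₁ = []} _ _ _ () _ _ _
    oversampled-merge _ _ {ρ₂ = []} _ _ _ _ _ () _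
    oversampled-merge ψ₁ ψ₂ {ρ₁@(x ∷ xs)} {ρ₂@(y ∷ ys)} bψ₁ bψ₂
      ((_ , wf₁ , sorted₁) , first₁ , final₁) ρ₁⊨ζ₁ ((_ , wf₂ , sorted₂) , first₂ , final₂) ρ₂⊨ζ₂ ρ₁≈ρ₂ =
      witness (proj₂ (merge-exists Sig ρ₁ ρ₂ s₁ s₂ ρ₁≈ρ₂))
      where
      s₁ = Linked⇒AllPairs ≤-trans sorted₁
      s₂ = Linked⇒AllPairs ≤-trans sorted₂
      qx = first₁ refl
      qy = first₂ refl
      qx₁ = intersects-mono ∈-++⁺ˡ qx
      qy₂ = intersects-mono ∈-++⁺ˡ qy
      witness : ∀ {o} → Merge Sig ρ₁ ρ₂ o →
        ∃ λ ρ → Oversampled Sig (X₁ ++ X₂) ρ × ρ ⊨ (ONF (Sig ++ X₁) ψ₁ ∧' ONF (Sig ++ X₂) ψ₂) ×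
                project Sig ρ ≈W project Sig ρ₁
      witness (takeˡ ¬qx _ _) = ⊥-elim (¬qx qx)
      witness (takeʳ ¬qy _ _) = ⊥-elim (¬qy qy)
      witness {o} M@(both _ _ _ _) =
        o ,
        ( ( (λ ())
          , merge-All Sig wellFormed-++ M (All.map (wellFormed-mono (++⁺ʳ Sig (xs⊆xs++ys X₁ X₂))) wf₁)
                                          (All.map (wellFormed-mono (++⁺ʳ Sig (xs⊆ys++xs X₂ X₁))) wf₂)
          , AllPairs⇒Linked (merge-sorted Sig M s₁ s₂))
        , (λ { refl → Any.++⁺ˡ qx })
        , Last⁻ (Active Sig) (merge-Last Sig M (Last⁺ (Active Sig) ρ₁ final₁) (Last⁺ (Active Sig) ρ₂ final₂))) ,
        ( aligned-ONF (merge-alignedˡ Γ₁∩Γ₂⊆Sig M wf₁ wf₂) qx₁ (Any.++⁺ˡ qx₁) ψ₁ bψ₁ ρ₁⊨ζ₁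
        , aligned-ONF (merge-alignedʳ Γ₁∩Γ₂⊆Sig M wf₁ wf₂) qy₂ (Any.++⁺ʳ _ qy₂) ψ₂ bψ₂ ρ₂⊨ζ₂) ,
        merge-project Sig M

lemma4 : (R : Reals) → let open Semantics R in
    (Sig X₁ X₂ : List Atom) →
    Disjoint Sig X₁ → Disjoint Sig X₂ → Disjoint X₁ X₂ →
    (φ₁ φ₂ ψ₁ ψ₂ : Formula) →
    BuiltFrom Sig φ₁ → BuiltFrom Sig φ₂ →
    BuiltFrom (Sig ++ X₁) ψ₁ → BuiltFrom (Sig ++ X₂) ψ₂ →
    EquiSat Sig X₁ φ₁ (ONF (Sig ++ X₁) ψ₁) →
    EquiSat Sig X₂ φ₂ (ONF (Sig ++ X₂) ψ₂) →
    EquiSat Sig (X₁ ++ X₂) (φ₁ ∧' φ₂) (ONF (Sig ++ X₁) ψ₁ ∧' ONF (Sig ++ X₂) ψ₂)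
lemma4 R Sig X₁ X₂ _ _ X₁#X₂ φ₁ φ₂ ψ₁ ψ₂ _ _ bψ₁ bψ₂ E₁ E₂ = sound , complete
  where
  open Semantics R
  sound : ∀ ρ → Oversampled Sig (X₁ ++ X₂) ρ → ρ ⊨ (ONF (Sig ++ X₁) ψ₁ ∧' ONF (Sig ++ X₂) ψ₂) →
          project Sig ρ ⊨ (φ₁ ∧' φ₂)
  sound ρ ov ρ⊨ζ =
    let ρ⊨ζ₁ , ρ⊨ζ₂ = ⊨-∧⁻ R ρ ρ⊨ζ
    in ⊨-∧⁺ R (project Sig ρ) (EquiSat-ONF-sound R Sig (X₁ ++ X₂) X₁ ψ₁ bψ₁ E₁ ov ρ⊨ζ₁)
                              (EquiSat-ONF-sound R Sig (X₁ ++ X₂) X₂ ψ₂ bψ₂ E₂ ov ρ⊨ζ₂)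
  complete : ∀ ρ → IsTimedWordOver Sig ρ → ρ ⊨ (φ₁ ∧' φ₂) →
    ∃ λ ρ' → Oversampled Sig (X₁ ++ X₂) ρ' × ρ' ⊨ (ONF (Sig ++ X₁) ψ₁ ∧' ONF (Sig ++ X₂) ψ₂) ×
             project Sig ρ' ≈W ρ
  complete ρ wf ρ⊨φ =
    let ρ⊨φ₁ , ρ⊨φ₂ = ⊨-∧⁻ R ρ ρ⊨φ
        ρ₁ , ov₁ , ρ₁⊨ζ₁ , ρ₁≈ρ = proj₂ E₁ ρ wf ρ⊨φ₁
        ρ₂ , ov₂ , ρ₂⊨ζ₂ , ρ₂≈ρ = proj₂ E₂ ρ wf ρ⊨φ₂
        ρ' , ov , ρ'⊨ζ , ρ'≈ρ₁ = oversampled-merge R Sig X₁ X₂ X₁#X₂ ψ₁ ψ₂ bψ₁ bψ₂ ov₁ ρ₁⊨ζ₁ ov₂ ρ₂⊨ζ₂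
                                   (≈W-trans R ρ₁≈ρ (≈W-sym R ρ₂≈ρ))
    in ρ' , ov , ρ'⊨ζ , ≈W-trans R ρ'≈ρ₁ ρ₁≈ρ
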